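{- Let $\ell\geq 3$ be an integer and let $G$ be a connected edge-transitive graph containing a path $P$ of length $\ell$ that does not close to a cycle. Let $L(G)$ be the line graph of $G$ and let $P'$ be the sequence of edges of $P$ along the path. Then $L(G)$ is a vertex-transitive graph and $P'$ is an induced path of length $\ell-1$ in $L(G)$ that does not close to an induced cycle.
   Context: All graphs are finite, simple and undirected. The line graph $L(G)$ has vertex set $E(G)$, two distinct edges being adjacent iff they share a vertex in $G$. A graph is vertex-transitive (resp. edge-transitive) if its automorphism group acts transitively on vertices (resp. on edges, via $\{x,y\}\mapsto\{\phi(x),\phi(y)\}$). A path of length $\ell$ is a sequence $(x_0,\dots,x_\ell)$ of pairwise distinct vertices with consecutive vertices adjacent. A cycle is a sequence $(x_0,\dots,x_{k-1},x_k=x_0)$ with $k\ge 3$, $x_0,\dots,x_{k-1}$ pairwise distinct and consecutive vertices adjacent. Paths and cycles are identified with the subgraphs formed by their vertices and edges and are induced if this subgraph is an induced subgraph. A path $P$ closes to a cycle if some cycle contains $P$ as a subgraph; an induced path closes to an induced cycle if some induced cycle contains it as an induced subgraph. -}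

module Defs where

open import Data.Nat using (ℕ; zero; suc; _≤_)
open import Data.Fin using (Fin; zero; suc; inject₁; fromℕ; _<_)
open import Data.Fin.Properties using (<-cmp)
open import Data.Bool using (Bool; true; false)
open import Data.Product using (Σ; ∃; ∃-syntax; _×_; _,_; proj₁; proj₂)
open import Data.Sum using (_⊎_; inj₁; inj₂)
open import Data.Empty using (⊥; ⊥-elim)
open import Relation.Nullary using (¬_)
open import Relation.Binary.Definitions using (tri<; tri≈; tri>)
open import Relation.Binary.PropositionalEquality
  using (_≡_; _≢_; refl; sym; trans; subst)
open import Relation.Binary.Construct.Closure.ReflexiveTransitive using (Star)
open import Function.Definitions using (Bijective)
open import Function.Base using (_∘_)

record Gph : Set₁ where
  field
    V   : Set
    _~_ : V → V → Set

open Gph public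

record SimpleGraph (n : ℕ) : Set where
  field
    adj    : Fin n → Fin n → Bool
    adj-sym    : ∀ x y → adj x y ≡ adj y x
    adj-irrefl : ∀ x → adj x x ≡ false

open SimpleGraph public

toGph : ∀ {n} → SimpleGraph n → Gph
toGph {n} G = record { V = Fin n ; _~_ = λ x y → adj G x y ≡ true }

record Automorphism (G : Gph) : Set where
  field
    fun       : V G → V G
    bijective : Bijective _≡_ _≡_ fun
    preserves : ∀ x y → (_~_ G x y → _~_ G (fun x) (fun y))
                      × (_~_ G (fun x) (fun y) → _~_ G x y)

open Automorphism public

VertexTransitive : Gph → Set
VertexTransitive G = ∀ (x y : V G) → Σ (Automorphism G) λ φ → fun φ x ≡ y

EdgeTransitive : Gph → Set
EdgeTransitive G = ∀ (x y u v : V G) → _~_ G x y → _~_ G u v →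
  Σ (Automorphism G) λ φ →
    (fun φ x ≡ u × fun φ y ≡ v) ⊎ (fun φ x ≡ v × fun φ y ≡ u)

Connected : Gph → Set
Connected G = ∀ (x y : V G) → Star (_~_ G) x y

record Path (G : Gph) (ℓ : ℕ) : Set where
  field
    vx   : Fin (suc ℓ) → V G
    inj  : ∀ i j → vx i ≡ vx j → i ≡ j
    step : ∀ (i : Fin ℓ) → _~_ G (vx (inject₁ i)) (vx (suc i))

open Path public

-- A cycle (x₀,…,x_{k-1},x_k = x₀) with k = suc m ≥ 3: the vertices
-- x₀,…,x_m are pairwise distinct, consecutive ones are adjacent and
-- x_m is adjacent to x₀.
record Cycle (G : Gph) (m : ℕ) : Set where
  field
    two≤m : 2 ≤ m
    cvx   : Fin (suc m) → V G
    cinj  : ∀ i j → cvx i ≡ cvx j → i ≡ j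
    cstep : ∀ (i : Fin m) → _~_ G (cvx (inject₁ i)) (cvx (suc i))
    close : _~_ G (cvx (fromℕ m)) (cvx zero)

open Cycle public

SeqEdge : ∀ {A : Set} {ℓ} → (Fin (suc ℓ) → A) → A → A → Set
SeqEdge {ℓ = ℓ} x u v = Σ (Fin ℓ) λ i →
  (x (inject₁ i) ≡ u × x (suc i) ≡ v) ⊎ (x (inject₁ i) ≡ v × x (suc i) ≡ u)

PathVertex : ∀ {G ℓ} → Path G ℓ → V G → Set
PathVertex P u = ∃[ i ] vx P i ≡ u

PathEdge : ∀ {G ℓ} → Path G ℓ → V G → V G → Set
PathEdge P u v = SeqEdge (vx P) u v

CycleVertex : ∀ {G m} → Cycle G m → V G → Set
CycleVertex C u = ∃[ i ] cvx C i ≡ u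

CycleEdge : ∀ {G m} → Cycle G m → V G → V G → Set
CycleEdge {m = m} C u v = SeqEdge (cvx C) u v
  ⊎ ((cvx C (fromℕ m) ≡ u × cvx C zero ≡ v) ⊎ (cvx C (fromℕ m) ≡ v × cvx C zero ≡ u))

InducedPath : ∀ {G ℓ} → Path G ℓ → Set
InducedPath {G} P = ∀ i j → _~_ G (vx P i) (vx P j) → PathEdge P (vx P i) (vx P j)

InducedCycle : ∀ {G m} → Cycle G m → Set
InducedCycle {G} C = ∀ i j → _~_ G (cvx C i) (cvx C j) → CycleEdge C (cvx C i) (cvx C j)

PathInCycle : ∀ {G ℓ m} → Path G ℓ → Cycle G m → Set
PathInCycle P C = (∀ u → PathVertex P u → CycleVertex C u)
                × (∀ u v → PathEdge P u v → CycleEdge C u v)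

PathInducedInCycle : ∀ {G ℓ m} → Path G ℓ → Cycle G m → Set
PathInducedInCycle P C = PathInCycle P C
  × (∀ u v → PathVertex P u → PathVertex P v → CycleEdge C u v → PathEdge P u v)

ClosesToCycle : ∀ {G ℓ} → Path G ℓ → Set
ClosesToCycle {G} P = ∃[ m ] Σ (Cycle G m) λ C → PathInCycle P C

ClosesToInducedCycle : ∀ {G ℓ} → Path G ℓ → Set
ClosesToInducedCycle {G} P =
  ∃[ m ] Σ (Cycle G m) λ C → InducedCycle C × PathInducedInCycle P C

Edge : ∀ {n} → SimpleGraph n → Set
Edge {n} G = Σ (Fin n) λ x → Σ (Fin n) λ y → (x < y) × (adj G x y ≡ true)

ends : ∀ {n} {G : SimpleGraph n} → Edge G → Fin n × Fin n
ends (x , y , _) = x , y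

ShareVertex : ∀ {n} {G : SimpleGraph n} → Edge G → Edge G → Set
ShareVertex (x , y , _) (u , v , _) = (x ≡ u ⊎ x ≡ v) ⊎ (y ≡ u ⊎ y ≡ v)

LineGraph : ∀ {n} → SimpleGraph n → Gph
LineGraph G = record
  { V   = Edge G
  ; _~_ = λ e f → e ≢ f × ShareVertex {G = G} e f }

mkEdge : ∀ {n} (G : SimpleGraph n) (x y : Fin n) → adj G x y ≡ true → Edge G
mkEdge G x y a with <-cmp x y
... | tri< x<y _ _ = x , y , x<y , a
... | tri≈ _ refl _ = ⊥-elim (false≢true (trans (sym (adj-irrefl G x)) a))
  where
    false≢true : false ≡ true → ⊥
    false≢true ()
... | tri> _ _ y<x = y , x , y<x , trans (adj-sym G y x) a

edgeSeq : ∀ {n} (G : SimpleGraph n) {k} → Path (toGph G) (suc k) → Fin (suc k) → Edge G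
edgeSeq G P i = mkEdge G (vx P (inject₁ i)) (vx P (suc i)) (step P i)

-- An automorphism of G moves edges to edges preserving incidence, so it is an
-- automorphism of L(G); edge-transitivity of G is therefore vertex-transitivity
-- of L(G).  The edges of P form an induced path P′ in L(G) with at least three
-- vertices, so P′ lies in no triangle.  In an induced cycle c₀, …, c_m of L(G)
-- with m ≥ 3, consecutive edges cᵢ, cᵢ₊₁ of G meet in a junction vertex wᵢ;
-- since only consecutive cᵢ may meet, the junctions are pairwise distinct and
-- form a cycle of G in which every cᵢ is the edge wᵢ₋₁wᵢ.  If P′ lay on that
-- induced cycle, this cycle of G would contain P.
module Submission where

open import Defs
open import Data.Nat using (ℕ; zero; suc; _+_; _≤_; _<_; z≤n; s≤s)
import Data.Nat.Properties as ℕ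
open import Data.Fin using (Fin; zero; suc; inject₁; fromℕ; toℕ)
open import Data.Fin.Properties
  using (<-cmp; <-irrelevant; <⇒≢; <-asym; suc-injective; inject₁-injective;
         toℕ-inject₁; toℕ-fromℕ; toℕ≤pred[n]; _≟_)
open import Data.Fin.Relation.Unary.Top
  using (view; ‵fromℕ; ‵inject₁; view-fromℕ; view-inject₁)
open import Data.Bool using (true)
import Data.Bool.Properties as Bool
open import Data.Product using (Σ; ∃-syntax; _×_; _,_; proj₁; proj₂; map₂)
open import Data.Sum using (_⊎_; inj₁; inj₂)
open import Data.Empty using (⊥-elim)
open import Relation.Nullary using (¬_; yes; no)
open import Relation.Binary.Definitions using (Symmetric; tri<; tri≈; tri>)
open import Relation.Binary.PropositionalEquality
  using (_≡_; _≢_; refl; sym; trans; subst; subst₂; cong; cong₂)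
open import Axiom.UniquenessOfIdentityProofs using (module Decidable⇒UIP)

-- SeqEdge x u v unfolds to Σ i. SamePair (x (inject₁ i)) (x (suc i)) u v.
SamePair : {A : Set} → A → A → A → A → Set
SamePair x y u v = (x ≡ u × y ≡ v) ⊎ (x ≡ v × y ≡ u)

SamePair-swap : {A : Set} {x y u v : A} → SamePair x y u v → SamePair x y v u
SamePair-swap (inj₁ (x≡u , y≡v)) = inj₂ (x≡u , y≡v)
SamePair-swap (inj₂ (x≡v , y≡u)) = inj₁ (x≡v , y≡u)

module EdgeProperties {n : ℕ} (G : SimpleGraph n) where

  Endpoint : Edge G → Fin n → Set
  Endpoint (x , y , _) z = z ≡ x ⊎ z ≡ y

  _∼_ : Edge G → Edge G → Set
  _∼_ = _~_ (LineGraph G)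

  adj⇒≢ : ∀ {x y} → adj G x y ≡ true → x ≢ y
  adj⇒≢ {x} a refl with trans (sym (adj-irrefl G x)) a
  ... | ()

  endpoints⇒≡ : (e f : Edge G) → (∀ {z} → Endpoint e z → Endpoint f z) → e ≡ f
  endpoints⇒≡ (x , y , x<y , a) (u , v , u<v , b) ⊆ with ⊆ (inj₁ refl) | ⊆ (inj₂ refl)
  ... | inj₁ refl | inj₂ refl =
    cong₂ (λ p q → x , y , p , q) (<-irrelevant x<y u<v) (Decidable⇒UIP.≡-irrelevant Bool._≟_ a b)
  ... | inj₁ refl | inj₁ refl = ⊥-elim (<⇒≢ x<y refl)
  ... | inj₂ refl | inj₂ refl = ⊥-elim (<⇒≢ x<y refl)
  ... | inj₂ refl | inj₁ refl = ⊥-elim (<-asym x<y u<v)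

  endpoints-adj : ∀ e {x y} → Endpoint e x → Endpoint e y → x ≢ y → adj G x y ≡ true
  endpoints-adj (u , v , _ , a) (inj₁ refl) (inj₂ refl) _  = a
  endpoints-adj (u , v , _ , a) (inj₂ refl) (inj₁ refl) _  = trans (adj-sym G v u) a
  endpoints-adj (u , v , _ , a) (inj₁ refl) (inj₁ refl) x≢y = ⊥-elim (x≢y refl)
  endpoints-adj (u , v , _ , a) (inj₂ refl) (inj₂ refl) x≢y = ⊥-elim (x≢y refl)

  endpoint≡either : ∀ e {x y z} → Endpoint e x → Endpoint e y → x ≢ y →
                    Endpoint e z → z ≡ x ⊎ z ≡ y
  endpoint≡either (u , v , _) (inj₁ refl) (inj₂ refl) _ z≡ = z≡
  endpoint≡either (u , v , _) (inj₂ refl) (inj₁ refl) _ (inj₁ z≡u) = inj₂ z≡u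
  endpoint≡either (u , v , _) (inj₂ refl) (inj₁ refl) _ (inj₂ z≡v) = inj₁ z≡v
  endpoint≡either (u , v , _) (inj₁ refl) (inj₁ refl) x≢y _ = ⊥-elim (x≢y refl)
  endpoint≡either (u , v , _) (inj₂ refl) (inj₂ refl) x≢y _ = ⊥-elim (x≢y refl)

  mkEdge-endpoints : ∀ x y (a : adj G x y ≡ true) →
                     Endpoint (mkEdge G x y a) x × Endpoint (mkEdge G x y a) y
  mkEdge-endpoints x y a with <-cmp x y
  ... | tri< _ _ _    = inj₁ refl , inj₂ refl
  ... | tri≈ _ refl _ = ⊥-elim (adj⇒≢ a refl)
  ... | tri> _ _ _    = inj₂ refl , inj₁ refl

  mkEdge-endpoint : ∀ x y (a : adj G x y ≡ true) {z} →
                    Endpoint (mkEdge G x y a) z → z ≡ x ⊎ z ≡ y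
  mkEdge-endpoint x y a = endpoint≡either (mkEdge G x y a) x∈ y∈ (adj⇒≢ a)
    where
      x∈ = proj₁ (mkEdge-endpoints x y a)
      y∈ = proj₂ (mkEdge-endpoints x y a)

  share⇒common : ∀ e f → ShareVertex {G = G} e f → ∃[ z ] Endpoint e z × Endpoint f z
  share⇒common (x , _) f (inj₁ x∈f) = x , inj₁ refl , x∈f
  share⇒common (_ , y , _) f (inj₂ y∈f) = y , inj₂ refl , y∈f

  common⇒share : ∀ e f {z} → Endpoint e z → Endpoint f z → ShareVertex {G = G} e f
  common⇒share (x , y , _) f (inj₁ refl) z∈f = inj₁ z∈f
  common⇒share (x , y , _) f (inj₂ refl) z∈f = inj₂ z∈f

  common⇒∼ : ∀ {e f z} → e ≢ f → Endpoint e z → Endpoint f z → e ∼ f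
  common⇒∼ {e} {f} e≢f z∈e z∈f = e≢f , common⇒share e f z∈e z∈f

  ∼-sym : Symmetric _∼_
  ∼-sym {e} {f} (e≢f , shared) with share⇒common e f shared
  ... | z , z∈e , z∈f = common⇒∼ (λ f≡e → e≢f (sym f≡e)) z∈f z∈e

-- Lifting automorphisms to the line graph

module LineAutomorphism {n : ℕ} (G : SimpleGraph n) (φ : Automorphism (toGph G)) where
  open EdgeProperties G

  mapEdge : Edge G → Edge G
  mapEdge (x , y , _ , a) = mkEdge G (fun φ x) (fun φ y) (proj₁ (preserves φ x y) a)

  mapEdge-endpoint : ∀ e {z} → Endpoint e z → Endpoint (mapEdge e) (fun φ z)
  mapEdge-endpoint (x , y , _ , a) (inj₁ refl) = proj₁ (mkEdge-endpoints (fun φ x) (fun φ y) _)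
  mapEdge-endpoint (x , y , _ , a) (inj₂ refl) = proj₂ (mkEdge-endpoints (fun φ x) (fun φ y) _)

  mapEdge-endpoint⁻ : ∀ e {z} → Endpoint (mapEdge e) z → ∃[ w ] Endpoint e w × fun φ w ≡ z
  mapEdge-endpoint⁻ (x , y , _ , a) z∈ with mkEdge-endpoint _ _ _ z∈
  ... | inj₁ z≡φx = x , inj₁ refl , sym z≡φx
  ... | inj₂ z≡φy = y , inj₂ refl , sym z≡φy

  mapEdge-≡ : ∀ e g → (∀ {z} → Endpoint g z → ∃[ w ] Endpoint e w × fun φ w ≡ z) → mapEdge e ≡ g
  mapEdge-≡ e g hits = sym (endpoints⇒≡ g (mapEdge e) covered)
    where
      covered : ∀ {z} → Endpoint g z → Endpoint (mapEdge e) z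
      covered z∈g with hits z∈g
      ... | w , w∈e , φw≡z = subst (Endpoint (mapEdge e)) φw≡z (mapEdge-endpoint e w∈e)

  mapEdge-injective : ∀ {e f} → mapEdge e ≡ mapEdge f → e ≡ f
  mapEdge-injective {e} {f} eq = endpoints⇒≡ e f e⊆f
    where
      e⊆f : ∀ {z} → Endpoint e z → Endpoint f z
      e⊆f {z} z∈e with mapEdge-endpoint⁻ f (subst (λ g → Endpoint g (fun φ z)) eq (mapEdge-endpoint e z∈e))
      ... | w , w∈f , φw≡φz = subst (Endpoint f) (proj₁ (bijective φ) φw≡φz) w∈f

  mapEdge-surjective : ∀ g → ∃[ e ] mapEdge e ≡ g
  mapEdge-surjective g@(u , v , _ , b) = e , mapEdge-≡ e g hits
    where
      preimage : ∀ z → ∃[ w ] fun φ w ≡ z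
      preimage z = proj₁ (proj₂ (bijective φ) z) , proj₂ (proj₂ (bijective φ) z) refl
      u′ = proj₁ (preimage u)
      v′ = proj₁ (preimage v)
      a : adj G u′ v′ ≡ true
      a = proj₂ (preserves φ u′ v′)
            (subst₂ (λ s t → adj G s t ≡ true) (sym (proj₂ (preimage u))) (sym (proj₂ (preimage v))) b)
      e = mkEdge G u′ v′ a
      hits : ∀ {z} → Endpoint g z → ∃[ w ] Endpoint e w × fun φ w ≡ z
      hits (inj₁ refl) = u′ , proj₁ (mkEdge-endpoints u′ v′ a) , proj₂ (preimage u)
      hits (inj₂ refl) = v′ , proj₂ (mkEdge-endpoints u′ v′ a) , proj₂ (preimage v)

  lineAutomorphism : Automorphism (LineGraph G)
  lineAutomorphism = record
    { fun       = mapEdge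
    ; bijective = mapEdge-injective
                , λ g → proj₁ (mapEdge-surjective g) , λ { refl → proj₂ (mapEdge-surjective g) }
    ; preserves = λ e f → preserve e f , reflect e f
    }
    where
      preserve : ∀ e f → e ∼ f → mapEdge e ∼ mapEdge f
      preserve e f (e≢f , shared) with share⇒common e f shared
      ... | z , z∈e , z∈f =
        common⇒∼ (λ eq → e≢f (mapEdge-injective eq)) (mapEdge-endpoint e z∈e) (mapEdge-endpoint f z∈f)
      reflect : ∀ e f → mapEdge e ∼ mapEdge f → e ∼ f
      reflect e f (e≢f , shared) with share⇒common (mapEdge e) (mapEdge f) shared
      ... | z , z∈e , z∈f with mapEdge-endpoint⁻ e z∈e | mapEdge-endpoint⁻ f z∈f
      ... | w , w∈e , φw≡z | w′ , w′∈f , φw′≡z =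
        common⇒∼ (λ eq → e≢f (cong mapEdge eq)) w∈e
                 (subst (Endpoint f) (proj₁ (bijective φ) (trans φw′≡z (sym φw≡z))) w′∈f)

edgeTransitive⇒lineGraph-vertexTransitive : ∀ {n} (G : SimpleGraph n) →
  EdgeTransitive (toGph G) → VertexTransitive (LineGraph G)
edgeTransitive⇒lineGraph-vertexTransitive G et e@(x , y , _ , a) g@(u , v , _ , b)
  with et x y u v a b
... | φ , inj₁ (φx≡u , φy≡v) =
  lineAutomorphism , mapEdge-≡ e g λ { (inj₁ refl) → x , inj₁ refl , φx≡u
                                     ; (inj₂ refl) → y , inj₂ refl , φy≡v }
  where open LineAutomorphism G φ
... | φ , inj₂ (φx≡v , φy≡u) =
  lineAutomorphism , mapEdge-≡ e g λ { (inj₁ refl) → y , inj₂ refl , φy≡u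
                                     ; (inj₂ refl) → x , inj₁ refl , φx≡v }
  where open LineAutomorphism G φ

-- The cyclic successor on Fin (suc m)

next : ∀ {m} → Fin (suc m) → Fin (suc m)
next a with view a
... | ‵fromℕ     = zero
... | ‵inject₁ i = suc i

prev : ∀ {m} → Fin (suc m) → Fin (suc m)
prev {m} zero = fromℕ m
prev (suc i)  = inject₁ i

next-fromℕ : ∀ m → next (fromℕ m) ≡ zero
next-fromℕ m rewrite view-fromℕ m = refl

next-inject₁ : ∀ {m} (i : Fin m) → next (inject₁ i) ≡ suc i
next-inject₁ i rewrite view-inject₁ i = refl

next-prev : ∀ {m} (b : Fin (suc m)) → next (prev b) ≡ b
next-prev {m} zero = next-fromℕ m
next-prev (suc i)  = next-inject₁ i

prev-next : ∀ {m} (a : Fin (suc m)) → prev (next a) ≡ a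
prev-next a with view a
... | ‵fromℕ     = refl
... | ‵inject₁ i = refl

next-injective : ∀ {m} {a b : Fin (suc m)} → next a ≡ next b → a ≡ b
next-injective {a = a} {b} eq = trans (sym (prev-next a)) (trans (cong prev eq) (prev-next b))

toℕ-next : ∀ {m} (a : Fin (suc m)) →
           toℕ (next a) ≡ suc (toℕ a) ⊎ (toℕ a ≡ m × toℕ (next a) ≡ 0)
toℕ-next a with view a
... | ‵fromℕ     = inj₂ (toℕ-fromℕ _ , refl)
... | ‵inject₁ i = inj₁ (cong suc (sym (toℕ-inject₁ i)))

iterate : {A : Set} → (A → A) → ℕ → A → A
iterate f zero    a = a
iterate f (suc j) a = f (iterate f j a)

-- Fewer than m + 1 steps wrap around at most once.
toℕ-iterate-next : ∀ {m} (a : Fin (suc m)) j → j ≤ m →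
  toℕ a + j ≡ toℕ (iterate next j a) ⊎ toℕ a + j ≡ toℕ (iterate next j a) + suc m
toℕ-iterate-next a zero _ = inj₁ (ℕ.+-identityʳ (toℕ a))
toℕ-iterate-next {m} a (suc j) j<m rewrite ℕ.+-suc (toℕ a) j
  with toℕ-iterate-next a j (ℕ.<⇒≤ j<m) | toℕ-next (iterate next j a)
... | inj₁ p | inj₁ q         = inj₁ (trans (cong suc p) (sym q))
... | inj₁ p | inj₂ (b≡m , q) = inj₂ (trans (cong suc (trans p b≡m)) (cong (_+ suc m) (sym q)))
... | inj₂ p | inj₁ q         = inj₂ (trans (cong suc p) (cong (_+ suc m) (sym q)))
... | inj₂ p | inj₂ (b≡m , _) = ⊥-elim (ℕ.<-irrefl (trans p (cong (_+ suc m) b≡m)) a+j<m+1+m)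
  where
    a+j<m+1+m : toℕ a + j < m + suc m
    a+j<m+1+m = ℕ.+-mono-≤-< (toℕ≤pred[n] a) (ℕ.m<n⇒m<1+n j<m)

iterate-next-≢ : ∀ {m} (a : Fin (suc m)) j → 1 ≤ j → j ≤ m → iterate next j a ≢ a
iterate-next-≢ {m} a (suc j) _ j<m eq with toℕ-iterate-next a (suc j) j<m
... | inj₁ p = ℕ.m+1+n≢m (toℕ a) (trans p (cong toℕ eq))
... | inj₂ p = ℕ.1+n≰n (subst (_≤ m) one-lap j<m)
  where
    one-lap : suc j ≡ suc m
    one-lap = ℕ.+-cancelˡ-≡ (toℕ a) _ _ (trans p (cong (λ b → toℕ b + suc m) eq))

mkCycle : ∀ {H : Gph} {m} → 2 ≤ m → (w : Fin (suc m) → V H) → (∀ a b → w a ≡ w b → a ≡ b) →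
          (∀ a → _~_ H (w a) (w (next a))) → Cycle H m
mkCycle {H} {m} 2≤m w w-injective w-adj = record
  { two≤m = 2≤m
  ; cvx   = w
  ; cinj  = w-injective
  ; cstep = λ i → subst (λ b → _~_ H (w (inject₁ i)) (w b)) (next-inject₁ i) (w-adj (inject₁ i))
  ; close = subst (λ b → _~_ H (w (fromℕ m)) (w b)) (next-fromℕ m) (w-adj (fromℕ m))
  }

module CycleProperties {H : Gph} {m : ℕ} (C : Cycle H m) where

  -- `next a` is computed by the same view, so `with view a` reduces it too.
  cvx-adj-next : ∀ a → _~_ H (cvx C a) (cvx C (next a))
  cvx-adj-next a with view a
  ... | ‵fromℕ     = close C
  ... | ‵inject₁ i = cstep C i

  consecutive⇒cycleEdge : ∀ a {u v} → SamePair (cvx C a) (cvx C (next a)) u v → CycleEdge C u v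
  consecutive⇒cycleEdge a with view a
  ... | ‵fromℕ     = inj₂
  ... | ‵inject₁ i = λ pair → inj₁ (i , pair)

  cycleEdge⇒consecutive : ∀ {u v} → CycleEdge C u v → ∃[ a ] SamePair (cvx C a) (cvx C (next a)) u v
  cycleEdge⇒consecutive {u} {v} (inj₁ (i , pair)) =
    inject₁ i , subst (λ b → SamePair (cvx C (inject₁ i)) (cvx C b) u v) (sym (next-inject₁ i)) pair
  cycleEdge⇒consecutive {u} {v} (inj₂ pair) =
    fromℕ m , subst (λ b → SamePair (cvx C (fromℕ m)) (cvx C b) u v) (sym (next-fromℕ m)) pair

  induced-adj⇒consecutive : InducedCycle C → ∀ a b → _~_ H (cvx C a) (cvx C b) → b ≡ next a ⊎ a ≡ next b
  induced-adj⇒consecutive induced a b a~b with cycleEdge⇒consecutive (induced a b a~b)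
  ... | c , inj₁ (p , q) = inj₁ (trans (sym (cinj C _ _ q)) (cong next (cinj C _ _ p)))
  ... | c , inj₂ (p , q) = inj₂ (trans (sym (cinj C _ _ q)) (cong next (cinj C _ _ p)))

Fin3-consecutive : (a b : Fin 3) → a ≢ b → b ≡ next a ⊎ a ≡ next b
Fin3-consecutive zero             zero             a≢b = ⊥-elim (a≢b refl)
Fin3-consecutive zero             (suc zero)       _   = inj₁ refl
Fin3-consecutive zero             (suc (suc zero)) _   = inj₂ refl
Fin3-consecutive (suc zero)       zero             _   = inj₂ refl
Fin3-consecutive (suc zero)       (suc zero)       a≢b = ⊥-elim (a≢b refl)
Fin3-consecutive (suc zero)       (suc (suc zero)) _   = inj₁ refl
Fin3-consecutive (suc (suc zero)) zero             _   = inj₁ refl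
Fin3-consecutive (suc (suc zero)) (suc zero)       _   = inj₂ refl
Fin3-consecutive (suc (suc zero)) (suc (suc zero)) a≢b = ⊥-elim (a≢b refl)

inducedPath-notInTriangle : ∀ {H : Gph} {k} → Symmetric (_~_ H) →
  (P : Path H (suc (suc k))) → InducedPath P →
  (C : Cycle H 2) → ¬ (∀ u → PathVertex P u → CycleVertex C u)
inducedPath-notInTriangle {H} ~-sym P induced C ⊆C
  with ⊆C _ (zero , refl) | ⊆C _ (suc (suc zero) , refl)
... | a , a↦x₀ | b , b↦x₂ = no-edge (induced zero two x₀~x₂)
  where
    open CycleProperties C using (cvx-adj-next)
    two = suc (suc zero)

    a≢b : a ≢ b
    a≢b a≡b with inj P zero two (trans (sym a↦x₀) (trans (cong (cvx C) a≡b) b↦x₂))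
    ... | ()

    x₀~x₂ : _~_ H (vx P zero) (vx P two)
    x₀~x₂ with Fin3-consecutive a b a≢b
    ... | inj₁ b≡next = subst₂ (_~_ H) a↦x₀ (trans (cong (cvx C) (sym b≡next)) b↦x₂) (cvx-adj-next a)
    ... | inj₂ a≡next = ~-sym (subst₂ (_~_ H) b↦x₂ (trans (cong (cvx C) (sym a≡next)) a↦x₀) (cvx-adj-next b))

    no-edge : ¬ PathEdge P (vx P zero) (vx P two)
    no-edge (t , inj₁ (p , q)) = not-0-2 t (inj P _ _ p) (inj P _ _ q)
      where
        not-0-2 : ∀ {k} (t : Fin (suc (suc k))) → inject₁ t ≡ zero → suc t ≢ suc (suc zero)
        not-0-2 zero    _  ()
        not-0-2 (suc t) () _
    no-edge (t , inj₂ (_ , q)) with inj P _ _ q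
    ... | ()

inject₁≢suc : ∀ {k} (i : Fin k) → inject₁ i ≢ suc i
inject₁≢suc zero    ()
inject₁≢suc (suc i) eq = inject₁≢suc i (suc-injective eq)

inject₁≡suc⇒suc≢inject₁ : ∀ {k} (i j : Fin k) → inject₁ i ≡ suc j → suc i ≢ inject₁ j
inject₁≡suc⇒suc≢inject₁ zero    _       ()
inject₁≡suc⇒suc≢inject₁ (suc i) zero    _ ()
inject₁≡suc⇒suc≢inject₁ (suc i) (suc j) p q =
  inject₁≡suc⇒suc≢inject₁ i j (suc-injective p) (suc-injective q)

module EdgePath {n : ℕ} (G : SimpleGraph n) {k : ℕ} (P : Path (toGph G) (suc k)) where
  open EdgeProperties G

  private
    x = vx P
    e = edgeSeq G P

  edgeSeq-endpoints : ∀ i → Endpoint (e i) (x (inject₁ i)) × Endpoint (e i) (x (suc i))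
  edgeSeq-endpoints i = mkEdge-endpoints (x (inject₁ i)) (x (suc i)) (step P i)

  edgeSeq-endpoint : ∀ i {z} → Endpoint (e i) z → z ≡ x (inject₁ i) ⊎ z ≡ x (suc i)
  edgeSeq-endpoint i = mkEdge-endpoint (x (inject₁ i)) (x (suc i)) (step P i)

  edgeSeq-injective : ∀ {i j} → e i ≡ e j → i ≡ j
  edgeSeq-injective {i} {j} eq
    with edgeSeq-endpoint j (subst (λ f → Endpoint f _) eq (proj₁ (edgeSeq-endpoints i)))
       | edgeSeq-endpoint j (subst (λ f → Endpoint f _) eq (proj₂ (edgeSeq-endpoints i)))
  ... | inj₁ p | _      = inject₁-injective (inj P _ _ p)
  ... | inj₂ _ | inj₂ q = suc-injective (inj P _ _ q)
  ... | inj₂ p | inj₁ q = ⊥-elim (inject₁≡suc⇒suc≢inject₁ i j (inj P _ _ p) (inj P _ _ q))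

  edgePath : Path (LineGraph G) k
  edgePath = record
    { vx   = e
    ; inj  = λ _ _ → edgeSeq-injective
    ; step = λ i → common⇒∼ (λ eq → inject₁≢suc i (edgeSeq-injective eq))
                            (proj₂ (edgeSeq-endpoints (inject₁ i))) (proj₁ (edgeSeq-endpoints (suc i)))
    }

  consecutive⇒pathEdge : ∀ {i j} → suc i ≡ inject₁ j → PathEdge edgePath (e i) (e j)
  consecutive⇒pathEdge {j = suc t} eq = t , inj₁ (cong e (sym (suc-injective eq)) , refl)

  edgePath-induced : InducedPath edgePath
  edgePath-induced i j (ei≢ej , shared) with share⇒common (e i) (e j) shared
  ... | z , z∈i , z∈j with edgeSeq-endpoint i z∈i | edgeSeq-endpoint j z∈j
  ... | inj₁ p | inj₁ q = ⊥-elim (ei≢ej (cong e (inject₁-injective (inj P _ _ (trans (sym p) q)))))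
  ... | inj₂ p | inj₂ q = ⊥-elim (ei≢ej (cong e (suc-injective (inj P _ _ (trans (sym p) q)))))
  ... | inj₂ p | inj₁ q = consecutive⇒pathEdge (inj P _ _ (trans (sym p) q))
  ... | inj₁ p | inj₂ q = map₂ SamePair-swap (consecutive⇒pathEdge (inj P _ _ (trans (sym q) p)))

  vertex-on-edgeSeq : ∀ j → ∃[ t ] Endpoint (e t) (x j)
  vertex-on-edgeSeq j with view j
  ... | ‵fromℕ     = fromℕ k , proj₂ (edgeSeq-endpoints (fromℕ k))
  ... | ‵inject₁ i = i , proj₁ (edgeSeq-endpoints i)

  pathEdge-on-edgeSeq : ∀ {u v} → PathEdge P u v → ∃[ t ] Endpoint (e t) u × Endpoint (e t) v × u ≢ v
  pathEdge-on-edgeSeq (t , inj₁ (refl , refl)) =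
    t , proj₁ (edgeSeq-endpoints t) , proj₂ (edgeSeq-endpoints t) , adj⇒≢ (step P t)
  pathEdge-on-edgeSeq (t , inj₂ (refl , refl)) =
    t , proj₂ (edgeSeq-endpoints t) , proj₁ (edgeSeq-endpoints t) , λ eq → adj⇒≢ (step P t) (sym eq)

-- Junctions of an induced cycle in the line graph

module JunctionCycle {n : ℕ} (G : SimpleGraph n) {m : ℕ} (C : Cycle (LineGraph G) m)
                     (induced : InducedCycle C) (3≤m : 3 ≤ m) where
  open EdgeProperties G
  open CycleProperties C using (cvx-adj-next; induced-adj⇒consecutive)

  private
    c = cvx C
    2≤m = two≤m C
    1≤m = ℕ.≤-trans (ℕ.n≤1+n 1) 2≤m

  meet⇒consecutive : ∀ {a b z} → a ≢ b → Endpoint (c a) z → Endpoint (c b) z → b ≡ next a ⊎ a ≡ next b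
  meet⇒consecutive {a} {b} a≢b z∈a z∈b =
    induced-adj⇒consecutive induced a b (common⇒∼ (λ eq → a≢b (cinj C a b eq)) z∈a z∈b)

  junction-spec : ∀ a → ∃[ z ] Endpoint (c a) z × Endpoint (c (next a)) z
  junction-spec a = share⇒common (c a) (c (next a)) (proj₂ (cvx-adj-next a))

  junction : Fin (suc m) → Fin n
  junction a = proj₁ (junction-spec a)

  junction∈ : ∀ a → Endpoint (c a) (junction a)
  junction∈ a = proj₁ (proj₂ (junction-spec a))

  junction∈next : ∀ a → Endpoint (c (next a)) (junction a)
  junction∈next a = proj₂ (proj₂ (junction-spec a))

  -- Otherwise cₐ and cₐ₊₂ meet, and inducedness forces a+2 ≡ a+1 or a+3 ≡ a.
  junction≢next : ∀ a → junction a ≢ junction (next a)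
  junction≢next a eq
    with meet⇒consecutive (λ a≡a₂ → iterate-next-≢ a 2 (s≤s z≤n) 2≤m (sym a≡a₂)) (junction∈ a)
                          (subst (Endpoint (c (next (next a)))) (sym eq) (junction∈next (next a)))
  ... | inj₁ a₂≡a₁ = iterate-next-≢ a 1 (s≤s z≤n) 1≤m (next-injective a₂≡a₁)
  ... | inj₂ a≡a₃  = iterate-next-≢ a 3 (s≤s z≤n) 3≤m (sym a≡a₃)

  junction-injective : ∀ a b → junction a ≡ junction b → a ≡ b
  junction-injective a b eq with a ≟ b
  ... | yes a≡b = a≡b
  ... | no a≢b with meet⇒consecutive a≢b (junction∈ a) (subst (Endpoint (c b)) (sym eq) (junction∈ b))
  ...   | inj₁ b≡next = ⊥-elim (junction≢next a (trans eq (cong junction b≡next)))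
  ...   | inj₂ a≡next = ⊥-elim (junction≢next b (trans (sym eq) (cong junction a≡next)))

  junctionCycle : Cycle (toGph G) m
  junctionCycle = mkCycle 2≤m junction junction-injective λ a →
    endpoints-adj (c (next a)) (junction∈next a) (junction∈ (next a)) (junction≢next a)

  endpoint⇒junction : ∀ b {z} → Endpoint (c b) z → z ≡ junction (prev b) ⊎ z ≡ junction b
  endpoint⇒junction b = endpoint≡either (c b) prev∈ (junction∈ b) prev≢
    where
      prev∈ : Endpoint (c b) (junction (prev b))
      prev∈ = subst (λ a → Endpoint (c a) (junction (prev b))) (next-prev b) (junction∈next (prev b))
      prev≢ : junction (prev b) ≢ junction b
      prev≢ = subst (λ a → junction (prev b) ≢ junction a) (next-prev b) (junction≢next (prev b))

  endpoints⇒junctionEdge : ∀ b {u v} → Endpoint (c b) u → Endpoint (c b) v → u ≢ v →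
                           CycleEdge junctionCycle u v
  endpoints⇒junctionEdge b {u} {v} u∈ v∈ u≢v =
    CycleProperties.consecutive⇒cycleEdge junctionCycle (prev b)
      (subst (λ a → SamePair (junction (prev b)) (junction a) u v) (sym (next-prev b)) pair)
    where
      pair : SamePair (junction (prev b)) (junction b) u v
      pair with endpoint⇒junction b u∈ | endpoint⇒junction b v∈
      ... | inj₁ p | inj₂ q = inj₁ (sym p , sym q)
      ... | inj₂ p | inj₁ q = inj₂ (sym q , sym p)
      ... | inj₁ p | inj₁ q = ⊥-elim (u≢v (trans p (sym q)))
      ... | inj₂ p | inj₂ q = ⊥-elim (u≢v (trans p (sym q)))

inducedCycle⊇edgePath⇒closesToCycle : ∀ {n} (G : SimpleGraph n) {k} (P : Path (toGph G) (suc k)) →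
  ∀ {m} (C : Cycle (LineGraph G) m) → InducedCycle C → 3 ≤ m →
  (∀ f → PathVertex (EdgePath.edgePath G P) f → CycleVertex C f) → ClosesToCycle P
inducedCycle⊇edgePath⇒closesToCycle G P C induced 3≤m ⊆C = _ , junctionCycle , vertices , edges
  where
    open EdgeProperties G
    open EdgePath G P
    open JunctionCycle G C induced 3≤m

    position : ∀ t → ∃[ b ] (∀ {z} → Endpoint (edgeSeq G P t) z → Endpoint (cvx C b) z)
    position t with ⊆C _ (t , refl)
    ... | b , cb≡et = b , subst (λ f → Endpoint f _) (sym cb≡et)

    vertices : ∀ u → PathVertex P u → CycleVertex junctionCycle u
    vertices u (j , refl) with vertex-on-edgeSeq j
    ... | t , x∈ with position t
    ... | b , into-cb with endpoint⇒junction b (into-cb x∈)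
    ...   | inj₁ eq = prev b , sym eq
    ...   | inj₂ eq = b , sym eq

    edges : ∀ u v → PathEdge P u v → CycleEdge junctionCycle u v
    edges u v uv with pathEdge-on-edgeSeq uv
    ... | t , u∈ , v∈ , u≢v with position t
    ... | b , into-cb = endpoints⇒junctionEdge b (into-cb u∈) (into-cb v∈) u≢v

edgePath-notClosesToInducedCycle : ∀ {n} (G : SimpleGraph n) {k} (P : Path (toGph G) (suc (suc (suc k)))) →
  ¬ ClosesToCycle P → ¬ ClosesToInducedCycle (EdgePath.edgePath G P)
edgePath-notClosesToInducedCycle G P _ (zero , C , _) with two≤m C
... | ()
edgePath-notClosesToInducedCycle G P _ (suc zero , C , _) with two≤m C
... | s≤s ()
edgePath-notClosesToInducedCycle G P _ (suc (suc zero) , C , _ , (⊆C , _) , _) =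
  inducedPath-notInTriangle ∼-sym edgePath edgePath-induced C ⊆C
  where open EdgeProperties G
        open EdgePath G P
edgePath-notClosesToInducedCycle G P ¬closes (suc (suc (suc m)) , C , induced , (⊆C , _) , _) =
  ¬closes (inducedCycle⊇edgePath⇒closesToCycle G P C induced (s≤s (s≤s (s≤s z≤n))) ⊆C)

corollary5p3 : (n k : ℕ) → 3 ≤ suc k → (G : SimpleGraph n) →
    Connected (toGph G) → EdgeTransitive (toGph G) →
    (P : Path (toGph G) (suc k)) → ¬ ClosesToCycle P →
    VertexTransitive (LineGraph G) ×
    Σ (Path (LineGraph G) k) (λ P′ →
      (∀ i → vx P′ i ≡ edgeSeq G P i) × InducedPath P′ × ¬ ClosesToInducedCycle P′)
corollary5p3 n zero          (s≤s ())       _ _ _ _ _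
corollary5p3 n (suc zero)    (s≤s (s≤s ())) _ _ _ _ _
corollary5p3 n (suc (suc k)) _ G _ edgeTransitive P ¬closes =
  edgeTransitive⇒lineGraph-vertexTransitive G edgeTransitive ,
  edgePath , (λ _ → refl) , edgePath-induced , edgePath-notClosesToInducedCycle G P ¬closes
  where open EdgePath G P
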